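{- U-MMB (with extended membership proofs) achieves recent-proof compatibility with parameter $c=1/5$: for all integers $1\le i\le n\le m$ with $m\le n+\frac15(n-i+1)$, the extended membership proof of the $i$-th leaf computed at state $n$ is valid against the commitment at state $m$. Equivalently, the peak of the mountain containing $h_i$ in the U-MMB with $m$ leaves is either an ancestor (or equal to the peak) of $h_i$ in the U-MMB with $n$ leaves, or, in case the mountain of $h_i$ at state $n$ forms a mergeable pair with an adjacent mountain, the node obtained by merging these two mountains.
   Context: A mountain of height $s\ge0$ is a perfect binary tree with $2^s$ leaves; its root is its peak. The U-MMB with $n$ leaves is an ordered (left-to-right) list of mountains whose leaves read left to right are $h_1,\dots,h_n$ ($h_i=H(x_i)$ for a hash function $H$; each non-leaf node is labelled with $H$ of the concatenation of its children), built inductively from the empty list: the $n$-th append (1) adds $h_n$ as a height-0 mountain at the right end, and (2) if there exist two consecutive mountains of equal height (a mergeable pair), takes the rightmost such pair, of height $s$, and replaces it in place by a mountain of height $s+1$ whose new peak has the two old peaks as children. The commitment at state $n$ is the list of peak hashes. The membership proof of $h_i$ at state $n$ is the list of hashes (with handedness) of siblings of the nodes on the path from $h_i$ up to (excluding) its peak; it is extended by appending the peak hash of the other mountain whenever the mountain of $h_i$ belongs to a mergeable pair. A proof is valid against a commitment if some prefix of it, hashed up from $h_i$, yields a peak hash of that commitment at the position consistent with index $i$. -}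

module Defs where

open import Data.Nat using (ℕ; zero; suc; _≡ᵇ_)
open import Data.Bool using (Bool; true; false; if_then_else_; _∨_)
open import Data.List using (List; []; _∷_; _++_; [_]; map; take)
open import Data.Maybe using (Maybe; just; nothing; _>>=_; fromMaybe)
open import Data.Product using (_×_; _,_; Σ)
open import Relation.Binary.PropositionalEquality using (_≡_)

-- The U-MMB shape does not depend on the data; hashes are computed
-- afterwards from a leaf-hash assignment and a node hash function.

data Tree : Set where
  leaf : ℕ → Tree
  node : Tree → Tree → Tree

-- height of a mountain (all mountains built below are perfect)
ht : Tree → ℕ
ht (leaf _)   = 0
ht (node l r) = suc (ht l)

contains : Tree → ℕ → Bool
contains (leaf j)   i = j ≡ᵇ i
contains (node l r) i = contains l i ∨ contains r i

mergeRightmost : List Tree → Maybe (List Tree)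
mergeRightmost []           = nothing
mergeRightmost (x ∷ [])     = nothing
mergeRightmost (x ∷ y ∷ zs) with mergeRightmost (y ∷ zs)
... | just r  = just (x ∷ r)
... | nothing = if ht x ≡ᵇ ht y then just (node x y ∷ zs) else nothing

append : List Tree → ℕ → List Tree
append ts n = let l = ts ++ [ leaf n ] in fromMaybe l (mergeRightmost l)

ummb : ℕ → List Tree
ummb zero    = []
ummb (suc n) = append (ummb n) (suc n)

nth : {X : Set} → List X → ℕ → Maybe X
nth []       _       = nothing
nth (x ∷ xs) zero    = just x
nth (x ∷ xs) (suc k) = nth xs k

locate : List Tree → ℕ → Maybe ℕ
locate []       i = nothing
locate (t ∷ ts) i =
  if contains t i then just zero else (locate ts i >>= λ k → just (suc k))

-- Hashes, commitments, membership proofs (over an arbitrary hash type A,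
-- leaf hashes h i = H(x_i), and node hash H2 l r = H(l ∥ r)).

-- handedness of a sibling: it is the left (L) or right (R) child
data Side : Set where
  L R : Side

module Hashing {A : Set} (H2 : A → A → A) (h : ℕ → A) where

  hashT : Tree → A
  hashT (leaf i)   = h i
  hashT (node l r) = H2 (hashT l) (hashT r)

  commitment : ℕ → List A
  commitment m = map hashT (ummb m)

  Proof : Set
  Proof = List (Side × A)

  pathIn : Tree → ℕ → Maybe Proof
  pathIn (leaf j)   i = if j ≡ᵇ i then just [] else nothing
  pathIn (node l r) i with pathIn l i
  ... | just p  = just (p ++ [ (R , hashT r) ])
  ... | nothing = pathIn r i >>= λ p → just (p ++ [ (L , hashT l) ])

  -- the other mountain of a mergeable pair containing the k-th mountain t
  -- (left neighbour checked first; in a U-MMB no three consecutive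
  -- mountains have equal height, so there is at most one such mountain)
  sameHeight : Tree → Maybe Tree → Maybe Tree
  sameHeight t nothing  = nothing
  sameHeight t (just u) = if ht u ≡ᵇ ht t then just u else nothing

  leftNb : List Tree → ℕ → Maybe Tree
  leftNb ts zero    = nothing
  leftNb ts (suc k) = nth ts k

  extend : List Tree → ℕ → Tree → Proof → Proof
  extend ts k t p with sameHeight t (leftNb ts k)
  ... | just u  = p ++ [ (L , hashT u) ]
  ... | nothing with sameHeight t (nth ts (suc k))
  ... | just u  = p ++ [ (R , hashT u) ]
  ... | nothing = p

  -- extended membership proof of h_i at state n (nothing if i ∉ [1,n])
  extProof : ℕ → ℕ → Maybe Proof
  extProof n i =
    locate (ummb n) i >>= λ k →
    nth (ummb n) k    >>= λ t →
    pathIn t i        >>= λ p →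
    just (extend (ummb n) k t p)

  hashUp : A → Proof → A
  hashUp a []             = a
  hashUp a ((L , s) ∷ q)  = hashUp (H2 s a) q
  hashUp a ((R , s) ∷ q)  = hashUp (H2 a s) q

  ValidAt : ℕ → ℕ → Proof → Set
  ValidAt m i π =
    Σ ℕ λ k → locate (ummb m) i ≡ just k ×
    Σ ℕ λ j → nth (commitment m) k ≡ just (hashUp (h i) (take j π))

{-# OPTIONS --safe #-}
module Submission where

-- Write n = 2 ^ h + y with 2 ^ h ≤ 2 (y + 1) and y + 1 < 2 ^ (h + 1), which is possible for
-- every n ≥ 1. The U-MMB with n leaves is then the perfect mountain of height h over the leaves
-- 1 … 2 ^ h followed by a shifted copy of the U-MMB with y leaves. This is proved by strong
-- induction on n together with the fact that appending leaf y + 1 to the U-MMB with y leaves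
-- creates no mergeable pair exactly when y + 2 is a power of two: so when h increases, the append
-- merges the two leading mountains of height h into one of height h + 1, and otherwise it only
-- acts on the tail.
--
-- For the theorem, peel leading mountains off the states n and m = n + d, where 5 d ≤ n - i + 1.
-- If leaf i lies in one of the first two mountains of state n, then either m starts with the same
-- mountains, or the decomposition of m has height h + 1 and exactly those two mountains have
-- merged; the bound on d ensures that the latter happens only when n already starts with two
-- mountains of height h. Otherwise leaf i lies in a tail common to both states, a smaller instance
-- with the same n - i, and the mergeable partner of its mountain is unchanged because the U-MMB
-- never starts with three mountains of equal height.

open import Defs
open import Data.Nat
  using (ℕ; zero; suc; _+_; _*_; _∸_; _^_; _≤_; _<_; _≡ᵇ_; s≤s; z≤n; _≤?_; _<?_)
open import Data.Nat.Properties
open import Data.Nat.Induction using (<-rec)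
open import Data.Nat.Tactic.RingSolver using (solve-∀; solve)
open import Data.Bool using (true; false; if_then_else_; _∨_; T)
open import Data.Unit using (tt)
open import Data.Bool.Properties using (∨-zeroʳ)
open import Data.List using (List; []; _∷_; _++_; [_]; map; head; take; length)
open import Data.List.Properties using (map-++; map-∘; map-cong; take-all)
open import Data.Maybe using (just; nothing; fromMaybe) renaming (map to mapMaybe)
open import Data.Product using (Σ; _×_; _,_; proj₁; proj₂)
open import Data.Sum using (_⊎_; inj₁; inj₂; [_,_]′)
open import Function using (_∘_)
open import Relation.Nullary using (¬_; yes; no; contradiction)
open import Relation.Binary.PropositionalEquality hiding ([_])

≤-via : ∀ {c d lo hi} → lo ≤ hi → c + hi ≡ d + lo → c ≤ d
≤-via {c} {d} {lo} {hi} lo≤hi eq =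
  +-cancelʳ-≤ hi c d (≤-trans (≤-reflexive eq) (+-monoʳ-≤ d lo≤hi))

≤-by : ∀ {c d} k → c + k ≡ d → c ≤ d
≤-by {c} k eq = ≤-trans (m≤m+n c k) (≤-reflexive eq)

≡ᵇ-refl : ∀ n → (n ≡ᵇ n) ≡ true
≡ᵇ-refl zero    = refl
≡ᵇ-refl (suc n) = ≡ᵇ-refl n

≡ᵇ-≢ : ∀ {m n} → m ≢ n → (m ≡ᵇ n) ≡ false
≡ᵇ-≢ {zero}  {zero}  m≢n = contradiction refl m≢n
≡ᵇ-≢ {zero}  {suc n} _   = refl
≡ᵇ-≢ {suc m} {zero}  _   = refl
≡ᵇ-≢ {suc m} {suc n} m≢n = ≡ᵇ-≢ (m≢n ∘ cong suc)

≡ᵇ-+ˡ : ∀ a m n → (a + m ≡ᵇ a + n) ≡ (m ≡ᵇ n)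
≡ᵇ-+ˡ zero    m n = refl
≡ᵇ-+ˡ (suc a) m n = ≡ᵇ-+ˡ a m n

2^-+ : ∀ h i → 2 ^ suc h + i ≡ 2 ^ h + (2 ^ h + i)
2^-+ h i = e (2 ^ h) i
  where e : ∀ a i → 2 * a + i ≡ a + (a + i)
        e = solve-∀

2^-cancel-< : ∀ {m n} → 2 ^ m < 2 ^ n → m < n
2^-cancel-< {m} {n} lt with m <? n
... | yes m<n = m<n
... | no  m≮n = contradiction lt (≤⇒≯ (^-monoʳ-≤ 2 (≮⇒≥ m≮n)))

2^-cancel-≤ : ∀ {m n} → 2 ^ m ≤ 2 ^ n → m ≤ n
2^-cancel-≤ {m} {n} le with m ≤? n
... | yes m≤n = m≤n
... | no  m≰n = contradiction le (<⇒≱ (^-monoʳ-< 2 (s≤s (s≤s z≤n)) (≰⇒> m≰n)))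

split-beyond : ∀ a {i} → ¬ i ≤ a → Σ ℕ λ j → a + j ≡ i × 1 ≤ j
split-beyond a i≰a with m≤n⇒∃[o]m+o≡n (<⇒≤ (≰⇒> i≰a))
... | j , refl = j , refl , n≢0⇒n>0 λ { refl → i≰a (≤-reflexive (+-identityʳ a)) }

shift : ℕ → Tree → Tree
shift a (leaf j)   = leaf (a + j)
shift a (node l r) = node (shift a l) (shift a r)

mountain : ℕ → Tree
mountain zero    = leaf 1
mountain (suc h) = node (mountain h) (shift (2 ^ h) (mountain h))

ht-shift : ∀ a t → ht (shift a t) ≡ ht t
ht-shift a (leaf j)   = refl
ht-shift a (node l r) = cong suc (ht-shift a l)

ht-mountain : ∀ h → ht (mountain h) ≡ h
ht-mountain zero    = refl
ht-mountain (suc h) = cong suc (ht-mountain h)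

shift-shift : ∀ a b t → shift a (shift b t) ≡ shift (a + b) t
shift-shift a b (leaf j)   = cong leaf (sym (+-assoc a b j))
shift-shift a b (node l r) = cong₂ node (shift-shift a b l) (shift-shift a b r)

map-shift-twice : ∀ h ts → map (shift (2 ^ h)) (map (shift (2 ^ h)) ts) ≡ map (shift (2 ^ suc h)) ts
map-shift-twice h ts = begin
  map (shift a) (map (shift a) ts) ≡⟨ map-∘ ts ⟨
  map (shift a ∘ shift a) ts       ≡⟨ map-cong (shift-shift a a) ts ⟩
  map (shift (a + a)) ts           ≡⟨ cong (λ b → map (shift (a + b)) ts) (+-identityʳ a) ⟨
  map (shift (2 ^ suc h)) ts       ∎
  where open ≡-Reasoning
        a = 2 ^ h

contains-shift : ∀ a t i → contains (shift a t) (a + i) ≡ contains t i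
contains-shift a (leaf j)   i = ≡ᵇ-+ˡ a j i
contains-shift a (node l r) i = cong₂ _∨_ (contains-shift a l i) (contains-shift a r i)

mountain-contains : ∀ h {i} → 1 ≤ i → i ≤ 2 ^ h → contains (mountain h) i ≡ true
mountain-contains zero    (s≤s z≤n) (s≤s z≤n) = refl
mountain-contains (suc h) {i} 1≤i i≤2a with i ≤? 2 ^ h
... | yes i≤a rewrite mountain-contains h 1≤i i≤a = refl
... | no i≰a with split-beyond (2 ^ h) i≰a
...   | j , refl , 1≤j = trans (cong (contains (mountain h) (a + j) ∨_) in-right) (∨-zeroʳ _)
  where
    a = 2 ^ h
    j≤a : j ≤ a
    j≤a = +-cancelˡ-≤ a j a (≤-trans i≤2a (≤-reflexive (cong (a +_) (+-identityʳ a))))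
    in-right : contains (shift a (mountain h)) (a + j) ≡ true
    in-right = trans (contains-shift a (mountain h) j) (mountain-contains h 1≤j j≤a)

mountain-excludes : ∀ h {i} → 1 ≤ i → contains (mountain h) (2 ^ h + i) ≡ false
mountain-excludes zero    (s≤s z≤n) = refl
mountain-excludes (suc h) {i} 1≤i rewrite 2^-+ h i
  | mountain-excludes h {2 ^ h + i} (≤-trans 1≤i (m≤n+m i (2 ^ h)))
  | contains-shift (2 ^ h) (mountain h) (2 ^ h + i)
  | mountain-excludes h 1≤i = refl

Mergeless : List Tree → Set
Mergeless ts = mergeRightmost ts ≡ nothing

mergeStep : List Tree → List Tree
mergeStep ts = fromMaybe ts (mergeRightmost ts)

-- The mountains just after the (y + 1)-th append has added its leaf and before it merges,
-- so that ummb (suc y) is mergeStep (appended y) by definition.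
appended : ℕ → List Tree
appended y = ummb y ++ [ leaf (suc y) ]

mergeRightmost-shift : ∀ a ts →
  mergeRightmost (map (shift a) ts) ≡ mapMaybe (map (shift a)) (mergeRightmost ts)
mergeRightmost-shift a []           = refl
mergeRightmost-shift a (x ∷ [])     = refl
mergeRightmost-shift a (x ∷ y ∷ zs) with mergeRightmost (y ∷ zs) | mergeRightmost-shift a (y ∷ zs)
... | just r  | eq rewrite eq = refl
... | nothing | eq rewrite eq | ht-shift a x | ht-shift a y with ht x ≡ᵇ ht y
...   | true  = refl
...   | false = refl

Mergeless-shift : ∀ a ts → Mergeless ts → Mergeless (map (shift a) ts)
Mergeless-shift a ts ml = trans (mergeRightmost-shift a ts) (cong (mapMaybe _) ml)

mergeRightmost-shift-just : ∀ a ts {r} → mergeRightmost ts ≡ just r →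
  mergeRightmost (map (shift a) ts) ≡ just (map (shift a) r)
mergeRightmost-shift-just a ts eq = trans (mergeRightmost-shift a ts) (cong (mapMaybe _) eq)

mergeRightmost-∷-just : ∀ p ts {r} → mergeRightmost ts ≡ just r →
  mergeRightmost (p ∷ ts) ≡ just (p ∷ r)
mergeRightmost-∷-just p (q ∷ qs) eq rewrite eq = refl

mergeRightmost-∷-nothing : ∀ p q qs → Mergeless (q ∷ qs) →
  mergeRightmost (p ∷ q ∷ qs) ≡ (if ht p ≡ᵇ ht q then just (node p q ∷ qs) else nothing)
mergeRightmost-∷-nothing p q qs ml rewrite ml = refl

unmerged-≢ : ∀ {A : Set} {m n} {x : A} → (if m ≡ᵇ n then just x else nothing) ≡ nothing → m ≢ n
unmerged-≢ {m = m} {x = x} eq refl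
  with () ← subst (λ b → (if b then just x else nothing) ≡ nothing) (≡ᵇ-refl m) eq

mergeless-∷-shift : ∀ p a {ts q} → Mergeless ts → head ts ≡ just q → ht q ≢ ht p →
  Mergeless (p ∷ map (shift a) ts)
mergeless-∷-shift p a {q ∷ qs} ml refl q≢p =
  trans (mergeRightmost-∷-nothing p (shift a q) (map (shift a) qs) (Mergeless-shift a (q ∷ qs) ml))
        (cong (if_then just (node p (shift a q) ∷ map (shift a) qs) else nothing)
              (trans (cong (ht p ≡ᵇ_) (ht-shift a q)) (≡ᵇ-≢ (q≢p ∘ sym))))

mergeless-∷-shift⁻ : ∀ p a ts → Mergeless (p ∷ map (shift a) ts) →
  Mergeless ts × (∀ {q} → head ts ≡ just q → ht q ≢ ht p)
mergeless-∷-shift⁻ p a []       _  = refl , λ ()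
mergeless-∷-shift⁻ p a (q ∷ qs) ml with mergeRightmost (q ∷ qs) in eq
... | just r
  with () ← trans (sym (mergeRightmost-∷-just p (map (shift a) (q ∷ qs)) (mergeRightmost-shift-just a (q ∷ qs) eq)))
                 ml
... | nothing = refl , λ { refl q≡p → unmerged-≢ unmerged (trans (sym q≡p) (sym (ht-shift a q))) }
  where
    unmerged = trans (sym (mergeRightmost-∷-nothing p (shift a q) (map (shift a) qs) (Mergeless-shift a (q ∷ qs) eq)))
                     ml

mergeStep-∷-shift : ∀ p a ts → (Mergeless ts → Σ Tree λ q → head ts ≡ just q × ht q ≢ ht p) →
  mergeStep (p ∷ map (shift a) ts) ≡ p ∷ map (shift a) (mergeStep ts)
mergeStep-∷-shift p a ts partnerless with mergeRightmost ts in eq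
... | just r =
  cong (fromMaybe _) (mergeRightmost-∷-just p (map (shift a) ts) (mergeRightmost-shift-just a ts eq))
... | nothing with partnerless refl
...   | q , hd , q≢p = cong (fromMaybe _) (mergeless-∷-shift p a eq hd q≢p)

merge-∷-shift : ∀ p a {q qs} → Mergeless (q ∷ qs) → ht q ≡ ht p →
  mergeStep (p ∷ map (shift a) (q ∷ qs)) ≡ node p (shift a q) ∷ map (shift a) qs
merge-∷-shift p a {q} {qs} ml q≡p =
  cong (fromMaybe _)
    (trans (mergeRightmost-∷-nothing p (shift a q) (map (shift a) qs) (Mergeless-shift a (q ∷ qs) ml))
    (cong (if_then just (node p (shift a q) ∷ map (shift a) qs) else nothing)
          (trans (cong (ht p ≡ᵇ_) (trans (ht-shift a q) q≡p)) (≡ᵇ-refl (ht p)))))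

-- Splitting off the first mountain

-- Band (2 ^ h) y is the condition under which ummb (2 ^ h + y) starts with a mountain of height h
-- (ummb-splits).
Band : ℕ → ℕ → Set
Band a y = a ≤ 2 * suc y × suc y < 2 * a

Leading : ℕ → ℕ → Set
Leading h y = Band (2 ^ h) y

leading-carry : ∀ h {y} → 2 + y ≡ 2 ^ suc h →
  Σ ℕ λ p → 2 ^ suc h + p ≡ suc (2 ^ h + y) × Leading (suc h) p
leading-carry h full with m≤n⇒∃[o]m+o≡n (m^n>0 2 h)
... | p , 1+p≡a =
  p , carry-index 1+p≡a full , (≤-reflexive (cong (2 *_) (sym 1+p≡a)) , carry-bound 1+p≡a)
  where
    carry-index : ∀ {a p y} → suc p ≡ a → 2 + y ≡ 2 * a → 2 * a + p ≡ suc (a + y)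
    carry-index {p = p} {y} refl e = +-cancelˡ-≡ 2 _ _ (begin
      2 + (2 * suc p + p)     ≡⟨ solve (p ∷ []) ⟩
      suc (suc p) + 2 * suc p ≡⟨ cong (suc (suc p) +_) e ⟨
      suc (suc p) + (2 + y)   ≡⟨ solve (p ∷ y ∷ []) ⟩
      2 + suc (suc p + y)     ∎)
      where open ≡-Reasoning
    carry-bound : ∀ {a p} → suc p ≡ a → suc p < 2 * (2 * a)
    carry-bound {p = p} refl = ≤-via (z≤n {2 + 3 * p}) (solve (p ∷ []))

leading-exists : ∀ n → 1 ≤ n → Σ ℕ λ h → Σ ℕ λ y → 2 ^ h + y ≡ n × Leading h y
leading-exists (suc zero)    _ = 0 , 0 , refl , (s≤s z≤n , s≤s (s≤s z≤n))
leading-exists (suc (suc n)) _ with leading-exists (suc n) (s≤s z≤n)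
... | h , y , eq , (lo , hi) with suc (suc y) <? 2 ^ suc h
...   | yes hi′ =
  h , suc y , trans (+-suc (2 ^ h) y) (cong suc eq) , (≤-trans lo (*-monoʳ-≤ 2 (n≤1+n (suc y))) , hi′)
...   | no ¬hi′ with leading-carry h (≤-antisym hi (≮⇒≥ ¬hi′))
...     | p , eq′ , lead = suc h , p , trans eq′ (cong suc eq) , lead

leading-pred : ∀ {h y} → Leading h (suc y) →
  Leading h y ⊎ Σ ℕ λ g → h ≡ suc g × 2 ^ g ≡ suc (suc y)
leading-pred {h} {y} (lo , hi) with 2 ^ h ≤? 2 * suc y
... | yes lo′ = inj₁ (lo′ , <-trans (n<1+n (suc y)) hi)
leading-pred {zero}  {y} _         | no ¬lo′ = contradiction (s≤s z≤n) ¬lo′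
leading-pred {suc g} {y} (lo , hi) | no ¬lo′ =
  inj₂ (g , refl , ≤-antisym (*-cancelˡ-≤ 2 lo) (*-cancelˡ-< 2 (suc y) (2 ^ g) (≰⇒> ¬lo′)))

Splits : ℕ → ℕ → Set
Splits h y = ummb (2 ^ h + y) ≡ mountain h ∷ map (shift (2 ^ h)) (ummb y)

-- Splits is proved by strong induction on the number of leaves 2 ^ h + y; SplitsBelow n is the
-- induction hypothesis, under which the facts about appends without merge are established.
SplitsBelow : ℕ → Set
SplitsBelow n = ∀ h y → 2 ^ h + y < n → Leading h y → Splits h y

SplitsBelow-mono : ∀ {m n} → m ≤ n → SplitsBelow n → SplitsBelow m
SplitsBelow-mono m≤n below h y lt = below h y (≤-trans lt m≤n)

appended-splits : ∀ h {y} → Splits h y →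
  appended (2 ^ h + y) ≡ mountain h ∷ map (shift (2 ^ h)) (appended y)
appended-splits h {y} split = begin
  ummb (a + y) ++ [ leaf (suc (a + y)) ]
    ≡⟨ cong (_++ [ leaf (suc (a + y)) ]) split ⟩
  (mountain h ∷ map (shift a) (ummb y)) ++ [ leaf (suc (a + y)) ]
    ≡⟨ cong (λ j → (mountain h ∷ map (shift a) (ummb y)) ++ [ leaf j ]) (+-suc a y) ⟨
  mountain h ∷ map (shift a) (ummb y) ++ [ shift a (leaf (suc y)) ]
    ≡⟨ cong (mountain h ∷_) (map-++ (shift a) (ummb y) [ leaf (suc y) ]) ⟨
  mountain h ∷ map (shift a) (appended y) ∎
  where open ≡-Reasoning
        a = 2 ^ h

PowerIfMergeless : ℕ → Set
PowerIfMergeless y =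
  Mergeless (appended y) → Σ ℕ λ j → 2 + y ≡ 2 ^ suc j × head (appended y) ≡ just (mountain j)

PowerIfMergeless-splits : ∀ h {w} → Leading h w → Splits h w → PowerIfMergeless w →
  PowerIfMergeless (2 ^ h + w)
PowerIfMergeless-splits h {w} (lo , hi) split power ml
  with mergeless-∷-shift⁻ (mountain h) (2 ^ h) (appended w) (subst Mergeless (appended-splits h split) ml)
... | ml-w , partnerless with power ml-w
...   | j , full , hd = h , full′ , cong head (appended-splits h split)
  where
    j≢h : j ≢ h
    j≢h j≡h = partnerless hd (cong (ht ∘ mountain) j≡h)
    h≤1+j : h ≤ suc j
    h≤1+j = ≤-pred (2^-cancel-< (begin-strict
      2 ^ h            ≤⟨ lo ⟩
      2 * suc w        <⟨ *-monoʳ-< 2 (n<1+n (suc w)) ⟩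
      2 * (2 + w)      ≡⟨ cong (2 *_) full ⟩
      2 ^ suc (suc j)  ∎))
      where open ≤-Reasoning
    j<h : j < h
    j<h = ≤∧≢⇒< (≤-pred (2^-cancel-≤ (≤-trans (≤-reflexive (sym full)) hi))) j≢h
    full′ : 2 + (2 ^ h + w) ≡ 2 ^ suc h
    full′ = twice full (cong (2 ^_) (≤-antisym j<h h≤1+j))
      where twice : ∀ {a b w} → 2 + w ≡ b → b ≡ a → 2 + (a + w) ≡ 2 * a
            twice {w = w} refl refl = solve (w ∷ [])

mergeless⇒power : ∀ y → SplitsBelow (suc y) → PowerIfMergeless y
mergeless⇒power = <-rec (λ y → SplitsBelow (suc y) → PowerIfMergeless y) step
  where
  step : ∀ y → (∀ {w} → w < y → SplitsBelow (suc w) → PowerIfMergeless w) →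
    SplitsBelow (suc y) → PowerIfMergeless y
  step zero    _   _     _ = 0 , refl , refl
  step (suc x) rec below with leading-exists (suc x) (s≤s z≤n)
  ... | h , w , eq , lead = subst PowerIfMergeless eq
        (PowerIfMergeless-splits h lead (below h w (s≤s (≤-reflexive eq)) lead)
          (rec w<1+x (SplitsBelow-mono (s≤s (<⇒≤ w<1+x)) below)))
    where
      w<1+x : w < suc x
      w<1+x = ≤-trans (+-monoˡ-≤ w (m^n>0 2 h)) (≤-reflexive eq)

mergeless-splits : ∀ h {w j} → Splits h w →
  Mergeless (appended w) → head (appended w) ≡ just (mountain j) → j ≢ h →
  Mergeless (appended (2 ^ h + w)) × head (appended (2 ^ h + w)) ≡ just (mountain h)
mergeless-splits h {j = j} split ml hd j≢h =
  subst Mergeless (sym (appended-splits h split)) (mergeless-∷-shift (mountain h) (2 ^ h) ml hd heights≢) ,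
  cong head (appended-splits h split)
  where
    heights≢ : ht (mountain j) ≢ ht (mountain h)
    heights≢ eq = j≢h (trans (sym (ht-mountain j)) (trans eq (ht-mountain h)))

power⇒mergeless : ∀ j {y} → 2 + y ≡ 2 ^ suc j → SplitsBelow (suc y) →
  Mergeless (appended y) × head (appended y) ≡ just (mountain j)
power⇒mergeless zero    refl _ = refl , refl
power⇒mergeless (suc g) {y} full below with m≤n⇒∃[o]m+o≡n (*-monoʳ-≤ 2 (m^n>0 2 g))
... | w , half = subst (λ x → Mergeless (appended x) × head (appended x) ≡ just (mountain (suc g))) b+w≡y
    (mergeless-splits (suc g) (below (suc g) w (s≤s (≤-reflexive b+w≡y)) (half-leading half))
                      ml hd (1+n≢n ∘ sym))
  where
    b+w≡y : 2 ^ suc g + w ≡ y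
    b+w≡y = halves half full
      where halves : ∀ {b w y} → 2 + w ≡ b → 2 + y ≡ 2 * b → b + w ≡ y
            halves {w = w} refl refl = solve (w ∷ [])
    half-leading : ∀ {b w} → 2 + w ≡ b → b ≤ 2 * suc w × suc w < 2 * b
    half-leading {w = w} refl = ≤-by w (solve (w ∷ [])) , ≤-by (2 + w) (solve (w ∷ []))
    ml×hd = power⇒mergeless g half
              (SplitsBelow-mono (s≤s (≤-trans (m≤n+m w _) (≤-reflexive b+w≡y))) below)
    ml = proj₁ ml×hd
    hd = proj₂ ml×hd

splits-grow : ∀ h {y} → suc (suc y) < 2 ^ suc h → Splits h y → PowerIfMergeless y → Splits h (suc y)
splits-grow h {y} hi split power = begin
  ummb (a + suc y)                                    ≡⟨ cong ummb (+-suc a y) ⟩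
  mergeStep (appended (a + y))                        ≡⟨ cong mergeStep (appended-splits h split) ⟩
  mergeStep (mountain h ∷ map (shift a) (appended y))
    ≡⟨ mergeStep-∷-shift (mountain h) a (appended y) partnerless ⟩
  mountain h ∷ map (shift a) (ummb (suc y))           ∎
  where
    open ≡-Reasoning
    a = 2 ^ h
    partnerless : Mergeless (appended y) →
      Σ Tree λ q → head (appended y) ≡ just q × ht q ≢ ht (mountain h)
    partnerless ml with power ml
    ... | j , full , hd = mountain j , hd , λ eq →
      <-irrefl (trans full (cong (λ k → 2 ^ suc k) (trans (sym (ht-mountain j)) (trans eq (ht-mountain h)))))
               hi

splits-carry : ∀ g {p} → 2 ^ g ≡ suc p → SplitsBelow (2 ^ suc g + p) → Splits (suc g) p
splits-carry g {p} a≡1+p below = begin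
  ummb (2 ^ suc g + p)                                    ≡⟨ cong ummb index ⟩
  mergeStep (appended (a + (p + p)))                      ≡⟨ cong mergeStep (appended-splits g split₂) ⟩
  mergeStep (mountain g ∷ map (shift a) (appended (p + p)))
    ≡⟨ cong (λ ts → mergeStep (mountain g ∷ map (shift a) ts)) appended-carry ⟩
  mergeStep (mountain g ∷ map (shift a) (mountain g ∷ map (shift a) (ummb p)))
    ≡⟨ merge-∷-shift (mountain g) a (subst Mergeless appended-carry ml) refl ⟩
  mountain (suc g) ∷ map (shift a) (map (shift a) (ummb p))
    ≡⟨ cong (mountain (suc g) ∷_) (map-shift-twice g (ummb p)) ⟩
  mountain (suc g) ∷ map (shift (2 ^ suc g)) (ummb p)     ∎
  where
    open ≡-Reasoning
    a = 2 ^ g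
    1+2p≡a+p : suc (p + p) ≡ a + p
    1+2p≡a+p = cong (_+ p) (sym a≡1+p)
    index : 2 ^ suc g + p ≡ suc (a + (p + p))
    index = trans (2^-+ g p) (trans (cong (a +_) (sym 1+2p≡a+p)) (+-suc a (p + p)))
    carry-bands : ∀ {a p} → a ≡ suc p → Band a (p + p) × Band a p
    carry-bands {p = p} refl =
      (≤-by (suc (3 * p)) (solve (p ∷ [])) , ≤-by 0 (solve (p ∷ []))) ,
      (≤-by (suc p) (solve (p ∷ [])) , ≤-by p (solve (p ∷ [])))
    carry-full : ∀ {a p} → a ≡ suc p → 2 + (p + p) ≡ 2 * a
    carry-full {p = p} refl = solve (p ∷ [])
    split₂ : Splits g (p + p)
    split₂ = below g (p + p) (≤-reflexive (sym index)) (proj₁ (carry-bands a≡1+p))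
    split₁ : Splits g p
    split₁ = below g p (≤-trans (s≤s (+-monoʳ-≤ a (m≤n+m p p))) (≤-reflexive (sym index)))
                   (proj₂ (carry-bands a≡1+p))
    ml : Mergeless (appended (p + p))
    ml = proj₁ (power⇒mergeless g (carry-full a≡1+p)
                  (SplitsBelow-mono (≤-trans (s≤s (m≤n+m (p + p) a)) (≤-reflexive (sym index))) below))
    appended-carry : appended (p + p) ≡ mountain g ∷ map (shift a) (ummb p)
    appended-carry = begin
      appended (p + p)   ≡⟨ cong (fromMaybe _) ml ⟨
      ummb (suc (p + p)) ≡⟨ cong ummb 1+2p≡a+p ⟩
      ummb (a + p)       ≡⟨ split₁ ⟩
      mountain g ∷ map (shift a) (ummb p) ∎

splits-step : ∀ h y → SplitsBelow (2 ^ h + y) → Leading h y → Splits h y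
splits-step zero          zero     _     _        = refl
splits-step (suc zero)    zero     _     _        = refl
splits-step (suc (suc g)) zero     _     (lo , _) =
  contradiction lo (<⇒≱ (^-monoʳ-< 2 (s≤s (s≤s z≤n)) {1} {suc (suc g)} (s≤s (s≤s z≤n))))
splits-step h             (suc y) below lead with leading-pred {h} lead
... | inj₁ lead′ = splits-grow h (proj₂ lead) (below h y (+-monoʳ-< (2 ^ h) (n<1+n y)) lead′)
                     (mergeless⇒power y (SplitsBelow-mono (m≤n+m (suc y) (2 ^ h)) below))
... | inj₂ (g , refl , a≡2+y) = splits-carry g a≡2+y below

splitsBelow : ∀ n → SplitsBelow n
splitsBelow (suc n) h y lt lead with m<1+n⇒m<n∨m≡n lt
... | inj₁ lt′ = splitsBelow n h y lt′ lead
... | inj₂ eq  = splits-step h y (subst SplitsBelow (sym eq) (splitsBelow n)) lead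

ummb-splits : ∀ h {y} → Leading h y → Splits h y
ummb-splits h {y} = splitsBelow (suc (2 ^ h + y)) h y ≤-refl

nth-map : ∀ {A B : Set} (f : A → B) xs k → nth (map f xs) k ≡ mapMaybe f (nth xs k)
nth-map f []       k       = refl
nth-map f (x ∷ xs) zero    = refl
nth-map f (x ∷ xs) (suc k) = nth-map f xs k

locate-shift : ∀ a ts i → locate (map (shift a) ts) (a + i) ≡ locate ts i
locate-shift a []       i = refl
locate-shift a (t ∷ ts) i rewrite contains-shift a t i | locate-shift a ts i = refl

record Loc (ts : List Tree) (i k : ℕ) (t : Tree) : Set where
  constructor found
  field
    located : locate ts i ≡ just k
    at      : nth ts k ≡ just t

Loc-head : ∀ {p ts i} → contains p i ≡ true → Loc (p ∷ ts) i 0 p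
Loc-head {p} {ts} {i} c = found located refl
  where located : locate (p ∷ ts) i ≡ just 0
        located rewrite c = refl

Loc-∷ : ∀ {p ts i k t} → contains p i ≡ false → Loc ts i k t → Loc (p ∷ ts) i (suc k) t
Loc-∷ {p} {ts} {i} {k} c (found l n) = found located n
  where located : locate (p ∷ ts) i ≡ just (suc k)
        located rewrite c | l = refl

Loc-shift : ∀ a {ts i k t} → Loc ts i k t → Loc (map (shift a) ts) (a + i) k (shift a t)
Loc-shift a {ts} {i} {k} (found l n) =
  found (trans (locate-shift a ts i) l) (trans (nth-map (shift a) ts k) (cong (mapMaybe _) n))

Loc-zero : ∀ {p ts i t} → Loc (p ∷ ts) i 0 t → t ≡ p
Loc-zero (found _ refl) = refl

Loc⇒contains : ∀ {ts i k t} → Loc ts i k t → contains t i ≡ true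
Loc⇒contains {[]}     (found () _)
Loc⇒contains {p ∷ ts} {i} (found l n) with contains p i in c
... | true with refl ← l | refl ← n = c
... | false with locate ts i in l′
...   | just k′ with refl ← l = Loc⇒contains {ts} (found l′ n)
...   | nothing with () ← l

Loc-head-contains : ∀ {p ts i t} → Loc (p ∷ ts) i 0 t → contains p i ≡ true
Loc-head-contains loc = subst (λ t → contains t _ ≡ true) (Loc-zero loc) (Loc⇒contains loc)

-- Grown ts k t M: M is the k-th mountain t of ts, or t merged with the neighbour whose
-- peak `extend` appends to the membership proof (the left one takes precedence).
data Grown (ts : List Tree) : ℕ → Tree → Tree → Set where
  stays        : ∀ {k t} → Grown ts k t t
  mergesLeft   : ∀ {k t u} → nth ts k ≡ just u → ht u ≡ ht t → Grown ts (suc k) t (node u t)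
  mergesRight₀ : ∀ {t u} → nth ts 1 ≡ just u → ht u ≡ ht t → Grown ts 0 t (node t u)
  mergesRight  : ∀ {k t u v} → nth ts k ≡ just v → ht v ≢ ht t →
                 nth ts (suc (suc k)) ≡ just u → ht u ≡ ht t → Grown ts (suc k) t (node t u)

nth-shift : ∀ a ts k {u} → nth ts k ≡ just u → nth (map (shift a) ts) k ≡ just (shift a u)
nth-shift a ts k nth≡ = trans (nth-map (shift a) ts k) (cong (mapMaybe _) nth≡)

ht-shift-≡ : ∀ a u t → ht u ≡ ht t → ht (shift a u) ≡ ht (shift a t)
ht-shift-≡ a u t eq = trans (ht-shift a u) (trans eq (sym (ht-shift a t)))

ht-shift-≢ : ∀ a u t → ht u ≢ ht t → ht (shift a u) ≢ ht (shift a t)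
ht-shift-≢ a u t u≢t eq = u≢t (trans (sym (ht-shift a u)) (trans eq (ht-shift a t)))

Grown-shift : ∀ a {ts k t M} → Grown ts k t M → Grown (map (shift a) ts) k (shift a t) (shift a M)
Grown-shift a      stays                                   = stays
Grown-shift a {ts} (mergesLeft {k} {t} {u} nth≡ u≡t)      =
  mergesLeft (nth-shift a ts k nth≡) (ht-shift-≡ a u t u≡t)
Grown-shift a {ts} (mergesRight₀ {t} {u} nth≡ u≡t)        =
  mergesRight₀ (nth-shift a ts 1 nth≡) (ht-shift-≡ a u t u≡t)
Grown-shift a {ts} (mergesRight {k} {t} {u} {v} nth≡ v≢t nth≡′ u≡t) =
  mergesRight (nth-shift a ts k nth≡) (ht-shift-≢ a v t v≢t)
              (nth-shift a ts (suc (suc k)) nth≡′) (ht-shift-≡ a u t u≡t)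

Grown-∷ : ∀ {p ts k t M} → (k ≡ 0 → ht p ≢ ht t) → Grown ts k t M → Grown (p ∷ ts) (suc k) t M
Grown-∷ _         stays                        = stays
Grown-∷ _         (mergesLeft nth≡ u≡t)        = mergesLeft nth≡ u≡t
Grown-∷ p≢t       (mergesRight₀ nth≡ u≡t)      = mergesRight refl (p≢t refl) nth≡ u≡t
Grown-∷ _         (mergesRight nth≡ v≢t nth≡′ u≡t) = mergesRight nth≡ v≢t nth≡′ u≡t

data Persists (ts us : List Tree) (i : ℕ) : Set where
  persists : ∀ {k t k′ M} → Loc ts i k t → Loc us i k′ M → Grown ts k t M → Persists ts us i

Persists-cong : ∀ {ts ts′ us us′ i} → ts ≡ ts′ → us ≡ us′ → Persists ts′ us′ i → Persists ts us i
Persists-cong refl refl P = P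

Persists-lift : ∀ a {p ts us i} → contains p (a + i) ≡ false → (∀ {t} → Loc ts i 0 t → ht p ≢ ht t) →
  Persists ts us i → Persists (p ∷ map (shift a) ts) (map (shift a) us) (a + i)
Persists-lift a c p≢first (persists {t = t} loc loc′ grown) =
  persists (Loc-∷ c (Loc-shift a loc)) (Loc-shift a loc′)
           (Grown-∷ (λ { refl p≡t → p≢first loc (trans p≡t (ht-shift a t)) }) (Grown-shift a grown))

Persists-∷ʳ : ∀ {q ts us i} → contains q i ≡ false → Persists ts us i → Persists ts (q ∷ us) i
Persists-∷ʳ c (persists loc loc′ grown) = persists loc (Loc-∷ c loc′) grown

persists-merge-right : ∀ {p q ts us i} → contains p i ≡ true → ht q ≡ ht p →
  Persists (p ∷ q ∷ ts) (node p q ∷ us) i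
persists-merge-right {p} {q} {i = i} c q≡p = persists (Loc-head c) (Loc-head c′) (mergesRight₀ refl q≡p)
  where c′ : contains (node p q) i ≡ true
        c′ rewrite c = refl

persists-merge-left : ∀ {p q ts us i} → contains p i ≡ false → contains q i ≡ true → ht p ≡ ht q →
  Persists (p ∷ q ∷ ts) (node p q ∷ us) i
persists-merge-left {p} {q} {i = i} ¬c c p≡q =
  persists (Loc-∷ ¬c (Loc-head c)) (Loc-head c′) (mergesLeft refl p≡q)
  where c′ : contains (node p q) i ≡ true
        c′ rewrite ¬c | c = refl

-- Recent states

band-+ : ∀ {a y} d → Band a y → suc (y + d) < 2 * a → Band a (y + d)
band-+ {y = y} d (lo , _) stay = ≤-trans lo (*-monoʳ-≤ 2 (s≤s (m≤m+n y d))) , stay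

-- Twin a y: for Band a y, the U-MMB with a + y leaves starts with two mountains over a leaves each.
Twin : ℕ → ℕ → Set
Twin a y = 3 * a ≤ 2 * suc y

band-twin : ∀ {a z} → Band a z → Twin a (a + z)
band-twin {a} {z} (lo , _) = ≤-via lo (solve (a ∷ z ∷ []))

¬band-triple : ∀ {a z} → ¬ Band a (a + (a + z))
¬band-triple {a} {z} (_ , hi) = ≤⇒≯ 2a≤a+a+z (<-trans (n<1+n _) hi)
  where 2a≤a+a+z : 2 * a ≤ a + (a + z)
        2a≤a+a+z = ≤-by z (solve (a ∷ z ∷ []))

twin-split : ∀ {a y} → 1 ≤ a → Band a y → Twin a y → Σ ℕ λ z → a + z ≡ y × Band a z
twin-split {a} {y} 1≤a (_ , hi) twin with m≤n⇒∃[o]m+o≡n (≤-pred (*-cancelˡ-< 2 a (suc y) 2a<2+2y))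
  where 2a<2+2y : suc (2 * a) ≤ 2 * suc y
        2a<2+2y = ≤-via (+-mono-≤ twin 1≤a) (solve (a ∷ y ∷ []))
... | z , refl = z , refl , (≤-via twin (solve (a ∷ z ∷ [])) , ≤-trans (s≤s (s≤s (m≤n+m z a))) hi)

-- This is where the constant 5 matters: a state a + y can leave its band within d ≤ (a + y) / 5
-- appends only if it already starts with two mountains of the same height.
overflow-twin : ∀ {a y d} → 5 * d ≤ a + y → ¬ suc (y + d) < 2 * a → Twin a y
overflow-twin {a} {y} {d} small overflow =
  *-cancelˡ-≤ 3 (≤-via (≤-trans (+-mono-≤ (*-monoʳ-≤ 5 (≮⇒≥ overflow)) small) (m≤m+n _ 1)) (identity a y d))
  where identity : ∀ a y d → 3 * (3 * a) + (5 * suc (y + d) + (a + y) + 1)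
                           ≡ 3 * (2 * suc y) + (5 * (2 * a) + 5 * d)
        identity = solve-∀

overflow-band : ∀ {a z d} → suc (a + z) < 2 * a → 5 * d ≤ a + (a + z) → ¬ suc (a + z + d) < 2 * a →
  Band (2 * a) (z + d)
overflow-band {a} {z} {d} hi small overflow =
  ≤-via (*-monoʳ-≤ 2 (≮⇒≥ overflow)) (identity₁ a z d) ,
  ≤-via (≤-trans (+-mono-≤ (*-monoʳ-≤ 2 hi) small) (m≤m+n _ (4 * d + 2))) (identity₂ a z d)
  where identity₁ : ∀ a z d → 2 * a + 2 * suc (a + z + d) ≡ 2 * suc (z + d) + 2 * (2 * a)
        identity₁ = solve-∀
        identity₂ : ∀ a z d → suc (suc (z + d)) + (2 * (2 * a) + (a + (a + z)) + (4 * d + 2))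
                            ≡ 2 * (2 * a) + (2 * suc (suc (a + z)) + 5 * d)
        identity₂ = solve-∀

single-stays : ∀ {a y d} → 1 ≤ a → ¬ Twin a y → 5 * d ≤ y → suc (y + d) < 2 * a
single-stays {a} {y} {d} 1≤a ¬twin small =
  *-cancelˡ-≤ 5 (≤-via (+-mono-≤ (+-mono-≤ small (*-monoʳ-≤ 3 (≰⇒> ¬twin))) 1≤a) (identity a y d))
  where identity : ∀ a y d → 5 * suc (suc (y + d)) + (y + 3 * (3 * a) + a)
                           ≡ 5 * (2 * a) + (5 * d + 3 * suc (2 * suc y) + 1)
        identity = solve-∀

ummb-stays : ∀ h {y} d → Leading h y → suc (y + d) < 2 ^ suc h →
  ummb (2 ^ h + y + d) ≡ mountain h ∷ map (shift (2 ^ h)) (ummb (y + d))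
ummb-stays h {y} d lead stay = trans (cong ummb (+-assoc (2 ^ h) y d)) (ummb-splits h (band-+ d lead stay))

ummb-overflows : ∀ h {z d} → Leading h (2 ^ h + z) → 5 * d ≤ 2 ^ h + (2 ^ h + z) →
  ¬ suc (2 ^ h + z + d) < 2 ^ suc h →
  ummb (2 ^ h + (2 ^ h + z) + d) ≡ mountain (suc h) ∷ map (shift (2 ^ suc h)) (ummb (z + d))
ummb-overflows h {z} {d} (_ , hi) small overflow =
  trans (cong ummb (index (2 ^ h) z d)) (ummb-splits (suc h) (overflow-band {2 ^ h} {z} {d} hi small overflow))
  where index : ∀ a z d → a + (a + z) + d ≡ 2 * a + (z + d)
        index = solve-∀

ummb-splits₂ : ∀ h {z} → Leading h (2 ^ h + z) → Leading h z →
  ummb (2 ^ h + (2 ^ h + z)) ≡ mountain h ∷ map (shift (2 ^ h)) (mountain h ∷ map (shift (2 ^ h)) (ummb z))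
ummb-splits₂ h lead lead-z =
  trans (ummb-splits h lead) (cong (λ ts → mountain h ∷ map (shift (2 ^ h)) ts) (ummb-splits h lead-z))

first-mountain : ∀ {y i t} → Loc (ummb y) i 0 t →
  Σ ℕ λ h → Σ ℕ λ z → 2 ^ h + z ≡ y × Leading h z × ht t ≡ h
first-mountain {zero}  (found () _)
first-mountain {suc y} loc with leading-exists (suc y) (s≤s z≤n)
... | h , z , eq , lead = h , z , eq , lead ,
      trans (cong ht (Loc-zero (subst (λ ts → Loc ts _ 0 _) (trans (cong ummb (sym eq)) (ummb-splits h lead)) loc)))
            (ht-mountain h)

second-mountain≢ : ∀ h {y i t} → ¬ Twin (2 ^ h) y → Loc (ummb y) i 0 t → ht (mountain h) ≢ ht t
second-mountain≢ h {y} ¬twin loc h≡t with first-mountain {y} loc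
... | h′ , z′ , refl , lead′ , t≡h′ with trans (sym (ht-mountain h)) (trans h≡t t≡h′)
...   | refl = ¬twin (band-twin lead′)

third-mountain≢ : ∀ h {z i t} → Leading h (2 ^ h + z) → Loc (ummb z) i 0 t → ht (mountain h) ≢ ht t
third-mountain≢ h {z} lead loc h≡t with first-mountain {z} loc
... | h″ , z″ , refl , _ , t≡h″ with trans (sym (ht-mountain h)) (trans h≡t t≡h″)
...   | refl = ¬band-triple lead

ummb-recent₂ : ∀ h {z d} → Leading h (2 ^ h + z) → Leading h z → 5 * d ≤ 2 ^ h + (2 ^ h + z) →
  ummb (2 ^ h + (2 ^ h + z) + d) ≡ mountain h ∷ map (shift (2 ^ h)) (mountain h ∷ map (shift (2 ^ h)) (ummb (z + d)))
  ⊎ ummb (2 ^ h + (2 ^ h + z) + d) ≡ mountain (suc h) ∷ map (shift (2 ^ h)) (map (shift (2 ^ h)) (ummb (z + d)))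
ummb-recent₂ h {z} {d} lead lead-z small with suc (2 ^ h + z + d) <? 2 ^ suc h
... | yes stay = inj₁ (trans (ummb-stays h d lead stay)
                             (cong (λ ts → mountain h ∷ map (shift (2 ^ h)) ts) (ummb-stays h d lead-z stay′)))
  where stay′ : suc (z + d) < 2 ^ suc h
        stay′ = ≤-trans (s≤s (s≤s (+-monoˡ-≤ d (m≤n+m z (2 ^ h))))) stay
... | no overflow = inj₂ (trans (ummb-overflows h lead small overflow)
                                (cong (mountain (suc h) ∷_) (sym (map-shift-twice h (ummb (z + d))))))

recent-≤ : ∀ {d r i n} → 5 * d ≤ suc r → 1 ≤ i → i + r ≡ n → 5 * d ≤ n
recent-≤ {r = r} small 1≤i i+r≡n = ≤-trans small (≤-trans (+-monoˡ-≤ r 1≤i) (≤-reflexive i+r≡n))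

persists-first : ∀ h {y d i} → Leading h y → 5 * d ≤ 2 ^ h + y → 1 ≤ i → i ≤ 2 ^ h →
  Persists (ummb (2 ^ h + y)) (ummb (2 ^ h + y + d)) i
persists-first h {y} {d} lead small 1≤i i≤a with suc (y + d) <? 2 ^ suc h
... | yes stay = Persists-cong (ummb-splits h lead) (ummb-stays h d lead stay)
                   (persists (Loc-head in-first) (Loc-head in-first) stays)
  where in-first = mountain-contains h 1≤i i≤a
... | no overflow with twin-split (m^n>0 2 h) lead (overflow-twin small overflow)
...   | z , refl , lead-z = Persists-cong (ummb-splits₂ h lead lead-z) (ummb-overflows h lead small overflow)
                              (persists-merge-right (mountain-contains h 1≤i i≤a) (ht-shift (2 ^ h) (mountain h)))

persists-beyond-first : ∀ h {y d i} → Leading h y → ¬ Twin (2 ^ h) y → 5 * d ≤ y → 1 ≤ i →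
  Persists (ummb y) (ummb (y + d)) i → Persists (ummb (2 ^ h + y)) (ummb (2 ^ h + y + d)) (2 ^ h + i)
persists-beyond-first h {d = d} lead ¬twin small 1≤i P =
  Persists-cong (ummb-splits h lead) (ummb-stays h d lead (single-stays (m^n>0 2 h) ¬twin small))
    (Persists-∷ʳ excluded (Persists-lift (2 ^ h) excluded (second-mountain≢ h ¬twin) P))
  where excluded = mountain-excludes h 1≤i

persists-in-second : ∀ h {z d i} → Leading h (2 ^ h + z) → Leading h z → 5 * d ≤ 2 ^ h + (2 ^ h + z) →
  1 ≤ i → i ≤ 2 ^ h → Persists (ummb (2 ^ h + (2 ^ h + z))) (ummb (2 ^ h + (2 ^ h + z) + d)) (2 ^ h + i)
persists-in-second h {z} {d} {i} lead lead-z small 1≤i i≤a =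
  [ (λ stays≡ → Persists-cong split (stays≡)
                  (persists (Loc-∷ excluded (Loc-head in-second)) (Loc-∷ excluded (Loc-head in-second)) stays))
  , (λ merged≡ → Persists-cong split merged≡
                   (persists-merge-left excluded in-second (sym (ht-shift (2 ^ h) (mountain h)))))
  ]′ (ummb-recent₂ h lead lead-z small)
  where
    split = ummb-splits₂ h lead lead-z
    excluded = mountain-excludes h 1≤i
    in-second = trans (contains-shift (2 ^ h) (mountain h) i) (mountain-contains h 1≤i i≤a)

persists-beyond-second : ∀ h {z d i} → Leading h (2 ^ h + z) → Leading h z → 5 * d ≤ 2 ^ h + (2 ^ h + z) →
  1 ≤ i → Persists (ummb z) (ummb (z + d)) i →
  Persists (ummb (2 ^ h + (2 ^ h + z))) (ummb (2 ^ h + (2 ^ h + z) + d)) (2 ^ h + (2 ^ h + i))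
persists-beyond-second h {z} {d} {i} lead lead-z small 1≤i P =
  [ (λ stays≡ → Persists-cong split stays≡
                  (Persists-∷ʳ excluded₂ (Persists-lift a excluded₂ not-in-second (Persists-∷ʳ excluded₁ inner))))
  , (λ merged≡ → Persists-cong split merged≡ (Persists-∷ʳ excluded₃ (Persists-lift a excluded₂ not-in-second inner)))
  ]′ (ummb-recent₂ h lead lead-z small)
  where
    a = 2 ^ h
    split = ummb-splits₂ h lead lead-z
    excluded₁ = mountain-excludes h 1≤i
    excluded₂ = mountain-excludes h (≤-trans 1≤i (m≤n+m i a))
    excluded₃ = subst (λ j → contains (mountain (suc h)) j ≡ false) (2^-+ h i) (mountain-excludes (suc h) 1≤i)
    inner = Persists-lift a excluded₁ (third-mountain≢ h lead) P
    not-in-second : ∀ {t} → Loc (mountain h ∷ map (shift a) (ummb z)) (a + i) 0 t → ht (mountain h) ≢ ht t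
    not-in-second loc = contradiction (trans (sym (Loc-head-contains loc)) excluded₁) λ ()

persists-later : ∀ h {y i r d} → Leading h y → i + r ≡ y → 5 * d ≤ suc r → 1 ≤ i →
  (∀ {j n} → 1 ≤ j → j ≤ i → j + r ≡ n → Persists (ummb n) (ummb (n + d)) j) →
  Persists (ummb (2 ^ h + y)) (ummb (2 ^ h + y + d)) (2 ^ h + i)
persists-later h {y} {i} {r} {d} lead tail small 1≤i ih with 3 * 2 ^ h ≤? 2 * suc y
... | no ¬twin = persists-beyond-first h lead ¬twin (recent-≤ {d} small 1≤i tail) 1≤i (ih 1≤i ≤-refl tail)
... | yes twin with twin-split (m^n>0 2 h) lead twin
...   | z , refl , lead-z with i ≤? 2 ^ h
...     | yes i≤a = persists-in-second h lead lead-z (≤-trans (recent-≤ {d} small 1≤i tail) (m≤n+m _ (2 ^ h))) 1≤i i≤a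
...     | no i≰a with split-beyond (2 ^ h) i≰a
...       | i′ , refl , 1≤i′ =
  persists-beyond-second h lead lead-z (≤-trans (recent-≤ {d} small 1≤i tail) (m≤n+m _ (2 ^ h))) 1≤i′
    (ih 1≤i′ (m≤n+m i′ (2 ^ h)) (+-cancelˡ-≡ (2 ^ h) _ _ (trans (sym (+-assoc (2 ^ h) i′ r)) tail)))

persists-within : ∀ {r d} → 5 * d ≤ suc r →
  ∀ i → 1 ≤ i → ∀ {n} → i + r ≡ n → Persists (ummb n) (ummb (n + d)) i
persists-within {r} {d} small = <-rec P step
  where
  P : ℕ → Set
  P i = 1 ≤ i → ∀ {n} → i + r ≡ n → Persists (ummb n) (ummb (n + d)) i
  step : ∀ i → (∀ {j} → j < i → P j) → P i
  step i rec 1≤i {n} i+r≡n with leading-exists n (≤-trans 1≤i (≤-trans (m≤m+n i r) (≤-reflexive i+r≡n)))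
  ... | h , y , refl , lead with i ≤? 2 ^ h
  ...   | yes i≤a = persists-first h lead (recent-≤ {d} small 1≤i i+r≡n) 1≤i i≤a
  ...   | no i≰a with split-beyond (2 ^ h) i≰a
  ...     | i′ , refl , 1≤i′ = persists-later h lead tail small 1≤i′ (λ 1≤j j≤i′ → rec (≤-<-trans j≤i′ i′<i) 1≤j)
    where
      i′<i : i′ < 2 ^ h + i′
      i′<i = +-monoˡ-≤ i′ (m^n>0 2 h)
      tail : i′ + r ≡ y
      tail = +-cancelˡ-≡ (2 ^ h) _ _ (trans (sym (+-assoc (2 ^ h) i′ r)) i+r≡n)
persists-recent : ∀ {i n m} → 1 ≤ i → i ≤ n → n ≤ m → 5 * m ≤ 5 * n + (n ∸ i + 1) →
  Persists (ummb n) (ummb m) i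
persists-recent {i} 1≤i i≤n n≤m recent with m≤n⇒∃[o]m+o≡n i≤n | m≤n⇒∃[o]m+o≡n n≤m
... | r , refl | d , refl = persists-within small i 1≤i refl
  where
    small : 5 * d ≤ suc r
    small = +-cancelˡ-≤ (5 * (i + r)) _ _ (begin
      5 * (i + r) + 5 * d           ≡⟨ *-distribˡ-+ 5 (i + r) d ⟨
      5 * (i + r + d)               ≤⟨ recent ⟩
      5 * (i + r) + (i + r ∸ i + 1) ≡⟨ cong (λ k → 5 * (i + r) + (k + 1)) (m+n∸m≡n i r) ⟩
      5 * (i + r) + (r + 1)         ≡⟨ cong (5 * (i + r) +_) (+-comm r 1) ⟩
      5 * (i + r) + suc r           ∎)
      where open ≤-Reasoning

-- Membership proofs

take-length-++ : ∀ {X : Set} (xs ys : List X) → take (length xs) (xs ++ ys) ≡ xs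
take-length-++ []       ys = refl
take-length-++ (x ∷ xs) ys = cong (x ∷_) (take-length-++ xs ys)

module _ {A : Set} (H2 : A → A → A) (h : ℕ → A) where
  open Hashing H2 h

  hashUp-++ : ∀ x π ρ → hashUp x (π ++ ρ) ≡ hashUp (hashUp x π) ρ
  hashUp-++ x []            ρ = refl
  hashUp-++ x ((L , s) ∷ π) ρ = hashUp-++ (H2 s x) π ρ
  hashUp-++ x ((R , s) ∷ π) ρ = hashUp-++ (H2 x s) π ρ

  pathIn-sound : ∀ t i {π} → pathIn t i ≡ just π → hashUp (h i) π ≡ hashT t
  pathIn-sound (leaf j)   i eq with j ≡ᵇ i in j≡i
  pathIn-sound (leaf j)   i refl | true = cong h (sym (≡ᵇ⇒≡ j i (subst T (sym j≡i) tt)))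
  pathIn-sound (node l r) i eq with pathIn l i in el
  pathIn-sound (node l r) i refl | just π =
    trans (hashUp-++ (h i) π [ (R , hashT r) ]) (cong (λ x → H2 x (hashT r)) (pathIn-sound l i el))
  ... | nothing with pathIn r i in er
  pathIn-sound (node l r) i refl | nothing | just π =
    trans (hashUp-++ (h i) π [ (L , hashT l) ]) (cong (H2 (hashT l)) (pathIn-sound r i er))

  pathIn-complete : ∀ t i → contains t i ≡ true → Σ Proof λ π → pathIn t i ≡ just π
  pathIn-complete (leaf j)   i c rewrite c = [] , refl
  pathIn-complete (node l r) i c with pathIn l i in el
  ... | just π = _ , refl
  ... | nothing with contains l i in cl
  ...   | true  with () ← trans (sym el) (proj₂ (pathIn-complete l i cl))
  ...   | false rewrite proj₂ (pathIn-complete r i c) = _ , refl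

  sameHeight-≡ : ∀ {t u} → ht u ≡ ht t → sameHeight t (just u) ≡ just u
  sameHeight-≡ {t} u≡t rewrite u≡t | ≡ᵇ-refl (ht t) = refl

  sameHeight-≢ : ∀ {t u} → ht u ≢ ht t → sameHeight t (just u) ≡ nothing
  sameHeight-≢ u≢t rewrite ≡ᵇ-≢ u≢t = refl

  extend-prefix : ∀ ts k t π → take (length π) (extend ts k t π) ≡ π
  extend-prefix ts k t π with sameHeight t (leftNb ts k)
  ... | just u  = take-length-++ π _
  ... | nothing with sameHeight t (nth ts (suc k))
  ...   | just u  = take-length-++ π _
  ...   | nothing = take-all (length π) π ≤-refl

  extend-left : ∀ {ts k t u} π → sameHeight t (leftNb ts k) ≡ just u →
    extend ts k t π ≡ π ++ [ (L , hashT u) ]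
  extend-left π eq rewrite eq = refl

  extend-right : ∀ {ts k t u} π → sameHeight t (leftNb ts k) ≡ nothing → sameHeight t (nth ts (suc k)) ≡ just u →
    extend ts k t π ≡ π ++ [ (R , hashT u) ]
  extend-right π eq eq′ rewrite eq | eq′ = refl

  hashUp-snoc : ∀ x {ρ} π e → ρ ≡ π ++ [ e ] →
    hashUp x (take (length ρ) ρ) ≡ hashUp (hashUp x π) [ e ]
  hashUp-snoc x π e refl = trans (cong (hashUp x) (take-all _ (π ++ [ e ]) ≤-refl)) (hashUp-++ x π [ e ])

  extend-reaches : ∀ {ts k t M} π x → hashUp x π ≡ hashT t → Grown ts k t M →
    Σ ℕ λ j → hashUp x (take j (extend ts k t π)) ≡ hashT M
  extend-reaches {ts} {k} {t} π x up stays = length π , trans (cong (hashUp x) (extend-prefix ts k t π)) up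
  extend-reaches {ts} {t = t} π x up (mergesLeft {k} {u = u} nth≡ u≡t) =
    length (extend ts (suc k) t π) ,
    trans (hashUp-snoc x π (L , hashT u)
            (extend-left {ts} {suc k} π (trans (cong (sameHeight t) nth≡) (sameHeight-≡ u≡t))))
          (cong (H2 (hashT u)) up)
  extend-reaches {ts} {t = t} π x up (mergesRight₀ {u = u} nth≡ u≡t) =
    length (extend ts 0 t π) ,
    trans (hashUp-snoc x π (R , hashT u)
            (extend-right {ts} {0} π refl (trans (cong (sameHeight t) nth≡) (sameHeight-≡ u≡t))))
          (cong (λ y → H2 y (hashT u)) up)
  extend-reaches {ts} {t = t} π x up (mergesRight {k} {u = u} nth≡ v≢t nth≡′ u≡t) =
    length (extend ts (suc k) t π) ,
    trans (hashUp-snoc x π (R , hashT u)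
            (extend-right {ts} {suc k} π (trans (cong (sameHeight t) nth≡) (sameHeight-≢ v≢t))
                                         (trans (cong (sameHeight t) nth≡′) (sameHeight-≡ u≡t))))
          (cong (λ y → H2 y (hashT u)) up)

  extProof-located : ∀ {n i k t π} → Loc (ummb n) i k t → pathIn t i ≡ just π →
    extProof n i ≡ just (extend (ummb n) k t π)
  extProof-located {n} {i} (found located at) path rewrite located | at | path = refl

  ValidAt-reached : ∀ {m i k′ M π} → Loc (ummb m) i k′ M → (Σ ℕ λ j → hashUp (h i) (take j π) ≡ hashT M) →
    ValidAt m i π
  ValidAt-reached {m} {k′ = k′} (found located at) (j , up) =
    k′ , located , j , trans (nth-map hashT (ummb m) k′) (trans (cong (mapMaybe hashT) at) (cong just (sym up)))

  extProof-valid : ∀ {n m i} → Persists (ummb n) (ummb m) i →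
    Σ Proof λ π → extProof n i ≡ just π × ValidAt m i π
  extProof-valid {n} {m} {i} (persists {k} {t} loc loc′ grown) with pathIn-complete t i (Loc⇒contains loc)
  ... | π , path = extend (ummb n) k t π , extProof-located {n} loc path ,
                   ValidAt-reached {m} loc′ (extend-reaches π (h i) (pathIn-sound t i path) grown)

lemma8 : {A : Set} (H2 : A → A → A) (h : ℕ → A) (i n m : ℕ) →
         1 ≤ i → i ≤ n → n ≤ m → 5 * m ≤ 5 * n + (n ∸ i + 1) →
         Σ (Hashing.Proof H2 h) λ π →
           Hashing.extProof H2 h n i ≡ just π × Hashing.ValidAt H2 h m i π
lemma8 H2 h i n m 1≤i i≤n n≤m recent =
  extProof-valid H2 h {n} {m} (persists-recent {i} {n} {m} 1≤i i≤n n≤m recent)
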